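{- Let $G$ be a locally bipartite graph and let $u,v$ be a sparse pair of vertices in $G$. Suppose that $C$ is a shortest odd cycle in $G$ which passes through $v$ and satisfies $C\setminus\{v\} \subseteq \Gamma(u)$. Then every neighbour of $u$ has at most two neighbours in $C$, and if it has two, then they are at distance two apart along $C$. In particular, $C$ is an induced cycle.
   Context: Graphs are finite and simple. A graph is locally bipartite if the neighbourhood of every vertex induces a bipartite graph. $\Gamma(u)$ is the neighbourhood of $u$. A pair of vertices $u,v$ is sparse if $u$ and $v$ are not adjacent and the subgraph induced on their common neighbourhood $\Gamma(u)\cap\Gamma(v)$ contains no edge. -}

module Defs where

open import Data.Nat using (ℕ; zero; suc; _+_; _*_; _≤_; _∸_; _⊓_; ∣_-_∣)
open import Data.Fin using (Fin; toℕ)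
open import Data.Bool using (Bool)
open import Data.Product using (Σ; _×_; ∃; ∃-syntax)
open import Data.Sum using (_⊎_)
open import Relation.Nullary using (¬_; Dec)
open import Relation.Binary.PropositionalEquality using (_≡_; _≢_)

Odd : ℕ → Set
Odd k = ∃[ m ] k ≡ suc (2 * m)

record Graph (n : ℕ) : Set₁ where
  field
    Adj    : Fin n → Fin n → Set
    adj?   : ∀ x y → Dec (Adj x y)
    sym    : ∀ {x y} → Adj x y → Adj y x
    irrefl : ∀ {x} → ¬ Adj x x

module _ {n : ℕ} (G : Graph n) where
  open Graph G

  NbhdBipartite : Fin n → Set
  NbhdBipartite w =
    Σ (Fin n → Bool) λ col →
      ∀ x y → Adj w x → Adj w y → Adj x y → col x ≢ col y

  LocallyBipartite : Set
  LocallyBipartite = ∀ w → NbhdBipartite w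

  SparsePair : Fin n → Fin n → Set
  SparsePair u v =
    ¬ Adj u v ×
    (∀ x y → Adj u x → Adj v x → Adj u y → Adj v y → ¬ Adj x y)

CycNext : (k : ℕ) → Fin k → Fin k → Set
CycNext k i j = (suc (toℕ i) ≡ toℕ j) ⊎ (suc (toℕ i) ≡ k × toℕ j ≡ 0)

cycDist : (k : ℕ) → Fin k → Fin k → ℕ
cycDist k i j = ∣ toℕ i - toℕ j ∣ ⊓ (k ∸ ∣ toℕ i - toℕ j ∣)

module _ {n : ℕ} (G : Graph n) where
  open Graph G

  record IsCycle (k : ℕ) (c : Fin k → Fin n) : Set where
    field
      len≥3  : 3 ≤ k
      inj    : ∀ i j → c i ≡ c j → i ≡ j
      edges  : ∀ i j → CycNext k i j → Adj (c i) (c j)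

  record GoodCycle (u v : Fin n) (k : ℕ) (c : Fin k → Fin n) : Set where
    field
      cycle   : IsCycle k c
      odd     : Odd k
      throughV : ∃[ i ] c i ≡ v
      restInΓu : ∀ i → c i ≢ v → Adj u (c i)

  ShortestGoodCycle : (u v : Fin n) (k : ℕ) (c : Fin k → Fin n) → Set
  ShortestGoodCycle u v k c =
    GoodCycle u v k c ×
    (∀ (k' : ℕ) (c' : Fin k' → Fin n) → GoodCycle u v k' c' → k ≤ k')

  InducedCycle : (k : ℕ) (c : Fin k → Fin n) → Set
  InducedCycle k c = ∀ i j → Adj (c i) (c j) → CycNext k i j ⊎ CycNext k j i

-- Let x ∈ Γ(u) ∪ {v} lie off an arc of C with l
-- edges and be adjacent to both of its ends: the arc closes through x into a cycle of length
-- l + 2. If l is odd, this cycle either passes through v, so k ≤ l + 2 by minimality of C, or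
-- lies inside the bipartite graph Γ(u), which is impossible. Whenever x sees two vertices of C,
-- two complementary arcs of C between them have lengths of odd sum, so one of them is odd and
-- therefore long. For x on C this rules out chords; for x ∈ Γ(u) off C it forces the two
-- vertices to be two apart, and a neighbour on C sees only its two cycle neighbours because C is
-- induced. Sparseness of u, v excludes k = 3, and on an odd cycle of length at least 5 no three
-- positions are pairwise two apart.
module Submission where

open import Defs
open import Data.Bool using (not)
open import Data.Bool.Properties using (¬-not; not-involutive)
open import Data.Empty using (⊥; ⊥-elim)
open import Data.Fin using (Fin; zero; suc; toℕ; fromℕ<)
open import Data.Fin.Properties using (toℕ-injective; toℕ<n; toℕ-fromℕ<; any?) renaming (_≟_ to _≟ᶠ_)
open import Data.Nat
  using (ℕ; zero; suc; _+_; _*_; _∸_; _≤_; _<_; _⊓_; ∣_-_∣; z≤n; s≤s; s≤s⁻¹; NonZero; >-nonZero; parity)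
open import Data.Nat.Properties
open import Data.Nat.DivMod
  using (_%_; _/_; _mod_; m≡m%n+[m/n]*n; m%n<n; m<n⇒m%n≡m; [m+n]%n≡m%n; [m+kn]%n≡m%n; n%n≡0)
open import Data.Nat.Divisibility using (_∣_; divides; >⇒∤)
open import Data.Nat.Tactic.RingSolver using (solve-∀)
open import Data.Parity.Base using (0ℙ; 1ℙ; _⁻¹)
open import Data.Parity.Properties using (suc-homo-⁻¹; +-homo-+; *-homo-*)
open import Data.Product using (_×_; _,_; proj₁; proj₂; ∃)
open import Data.Sum using (_⊎_; inj₁; inj₂; [_,_]; swap)
open import Relation.Binary.Definitions using (Tri; tri<; tri≈; tri>)
open import Relation.Binary.PropositionalEquality
  using (_≡_; _≢_; refl; sym; trans; cong; cong₂; subst; subst₂; module ≡-Reasoning)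
open import Relation.Nullary using (¬_; Dec; yes; no)
open import Function using (_∘_; id)

Odd⇒parity≡1ℙ : ∀ {m} → Odd m → parity m ≡ 1ℙ
Odd⇒parity≡1ℙ (h , refl) = trans (+-homo-+ 1 (2 * h)) (cong _⁻¹ (*-homo-* 2 h))

parity≡1ℙ⇒Odd : ∀ m → parity m ≡ 1ℙ → Odd m
parity≡1ℙ⇒Odd zero ()
parity≡1ℙ⇒Odd (suc zero) _ = 0 , refl
parity≡1ℙ⇒Odd (suc (suc m)) odd with parity≡1ℙ⇒Odd m odd
... | h , refl = suc h , cong suc (sym (*-suc 2 h))

parity-suc-odd : ∀ {m} → parity m ≡ 1ℙ → parity (suc m) ≡ 0ℙ
parity-suc-odd {m} odd = sym (trans (cong _⁻¹ (sym odd)) (suc-homo-⁻¹ (suc m)))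

parity-+≡1ℙ : ∀ m n → parity (m + n) ≡ 1ℙ →
  (parity m ≡ 1ℙ × parity n ≡ 0ℙ) ⊎ (parity m ≡ 0ℙ × parity n ≡ 1ℙ)
parity-+≡1ℙ m n odd with parity m | parity n | trans (sym (+-homo-+ m n)) odd
... | 1ℙ | 0ℙ | _ = inj₁ (refl , refl)
... | 0ℙ | 1ℙ | _ = inj₂ (refl , refl)

even-1≤-≤2 : ∀ {m} → 1 ≤ m → m ≤ 2 → parity m ≡ 0ℙ → m ≡ 2
even-1≤-≤2 {suc (suc zero)} _ _ _ = refl
even-1≤-≤2 {suc zero} _ _ ()
even-1≤-≤2 {suc (suc (suc _))} _ (s≤s (s≤s ())) _

%-≡⇒∣∸ : ∀ m n k .{{_ : NonZero k}} → m % k ≡ n % k → k ∣ n ∸ m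
%-≡⇒∣∸ m n k eq = divides (n / k ∸ m / k) (begin
  n ∸ m                                       ≡⟨ cong₂ _∸_ (m≡m%n+[m/n]*n n k) (m≡m%n+[m/n]*n m k) ⟩
  (n % k + n / k * k) ∸ (m % k + m / k * k)   ≡⟨ cong (λ r → n % k + n / k * k ∸ (r + m / k * k)) eq ⟩
  (n % k + n / k * k) ∸ (n % k + m / k * k)   ≡⟨ [m+n]∸[m+o]≡n∸o (n % k) _ _ ⟩
  n / k * k ∸ m / k * k                       ≡⟨ *-distribʳ-∸ k (n / k) (m / k) ⟨
  (n / k ∸ m / k) * k                         ∎)
  where open ≡-Reasoning

∣∧<⇒≡0 : ∀ {k d} → k ∣ d → d < k → d ≡ 0
∣∧<⇒≡0 {d = zero} _ _ = refl
∣∧<⇒≡0 {d = suc d} k∣d d<k = ⊥-elim (>⇒∤ d<k k∣d)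

%-injectiveʳ-≤ : ∀ s {t t' k} .{{_ : NonZero k}} → t ≤ t' → t' < k → (s + t) % k ≡ (s + t') % k → t ≡ t'
%-injectiveʳ-≤ s {t} {t'} {k} t≤t' t'<k eq =
  ≤-antisym t≤t' (m∸n≡0⇒m≤n (∣∧<⇒≡0 k∣t'∸t (≤-<-trans (m∸n≤m t' t) t'<k)))
  where
    k∣t'∸t : k ∣ t' ∸ t
    k∣t'∸t = subst (k ∣_) ([m+n]∸[m+o]≡n∸o s t' t) (%-≡⇒∣∸ (s + t) (s + t') k eq)

%-injectiveʳ : ∀ s {t t' k} .{{_ : NonZero k}} → t < k → t' < k → (s + t) % k ≡ (s + t') % k → t ≡ t'
%-injectiveʳ s {t} {t'} t<k t'<k eq with ≤-total t t'
... | inj₁ t≤t' = %-injectiveʳ-≤ s t≤t' t'<k eq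
... | inj₂ t'≤t = sym (%-injectiveʳ-≤ s t'≤t t<k (sym eq))

-- Positions p and p + g of a k-cycle are at cycle distance two.
GapTwo : ℕ → ℕ → Set
GapTwo k g = g ≡ 2 ⊎ 2 + g ≡ k

gapTwo⇒⊓≡2 : ∀ {k g} → 4 ≤ k → GapTwo k g → g ⊓ (k ∸ g) ≡ 2
gapTwo⇒⊓≡2 4≤k (inj₁ refl) = m≤n⇒m⊓n≡m (m+n≤o⇒m≤o∸n 2 4≤k)
gapTwo⇒⊓≡2 {g = g} 4≤k (inj₂ refl) =
  trans (cong (g ⊓_) (m+n∸n≡m 2 g)) (m≥n⇒m⊓n≡n (s≤s⁻¹ (s≤s⁻¹ 4≤k)))

¬gapTwo-self : ∀ {k} → 4 ≤ k → ¬ GapTwo k k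
¬gapTwo-self (s≤s (s≤s ())) (inj₁ refl)
¬gapTwo-self {k} _ (inj₂ 2+k≡k) = m≢1+n+m k (sym 2+k≡k)

gapTwo-sum : ∀ {k x y} → 4 ≤ k → parity k ≡ 1ℙ → GapTwo k x → GapTwo k y → ¬ GapTwo k (x + y)
gapTwo-sum _ _ (inj₁ refl) (inj₁ refl) (inj₁ ())
gapTwo-sum _ () (inj₁ refl) (inj₁ refl) (inj₂ refl)
gapTwo-sum 4≤k _ (inj₁ refl) (inj₂ refl) = ¬gapTwo-self 4≤k
gapTwo-sum {x = x} 4≤k _ (inj₂ refl) (inj₁ refl) = ¬gapTwo-self 4≤k ∘ subst (GapTwo _) (+-comm x 2)
gapTwo-sum {x = suc (suc x)} _ _ (inj₂ refl) (inj₂ refl) (inj₁ 2x≡2) =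
  m+1+n≢0 x (suc-injective (suc-injective 2x≡2))
gapTwo-sum {x = suc (suc x)} _ _ (inj₂ refl) (inj₂ refl) (inj₂ 2+2x≡2+x) =
  m+1+n≢m (2 + x) (suc-injective (suc-injective 2+2x≡2+x))
gapTwo-sum {x = zero} (s≤s (s≤s ())) _ (inj₂ refl) (inj₂ refl)
gapTwo-sum {x = suc zero} (s≤s (s≤s (s≤s ()))) _ (inj₂ refl) (inj₂ refl)

∣-∣-between : ∀ {a b c} → a ≤ b → b ≤ c → ∣ a - c ∣ ≡ ∣ a - b ∣ + ∣ b - c ∣
∣-∣-between {a} {b} {c} a≤b b≤c = begin
  ∣ a - c ∣              ≡⟨ m≤n⇒∣m-n∣≡n∸m (≤-trans a≤b b≤c) ⟩
  c ∸ a                  ≡⟨ cong (_∸ a) (m∸n+n≡m b≤c) ⟨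
  c ∸ b + b ∸ a          ≡⟨ +-∸-assoc (c ∸ b) a≤b ⟩
  c ∸ b + (b ∸ a)        ≡⟨ +-comm (c ∸ b) (b ∸ a) ⟩
  b ∸ a + (c ∸ b)        ≡⟨ cong₂ _+_ (m≤n⇒∣m-n∣≡n∸m a≤b) (m≤n⇒∣m-n∣≡n∸m b≤c) ⟨
  ∣ a - b ∣ + ∣ b - c ∣  ∎
  where open ≡-Reasoning

noGapTwoTriangle : ∀ {k} → 4 ≤ k → parity k ≡ 1ℙ → ∀ a b c →
  GapTwo k ∣ a - b ∣ → GapTwo k ∣ b - c ∣ → ¬ GapTwo k ∣ a - c ∣
noGapTwoTriangle {k} 4≤k odd a b c ab bc ac = byOrder (≤-total a b) (≤-total b c) (≤-total a c)
  where
    flip : ∀ x y → GapTwo k ∣ x - y ∣ → GapTwo k ∣ y - x ∣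
    flip x y = subst (GapTwo k) (∣-∣-comm x y)

    sorted : ∀ {x y z} → x ≤ y → y ≤ z → GapTwo k ∣ x - y ∣ → GapTwo k ∣ y - z ∣ → ¬ GapTwo k ∣ x - z ∣
    sorted x≤y y≤z xy yz xz = gapTwo-sum 4≤k odd xy yz (subst (GapTwo k) (∣-∣-between x≤y y≤z) xz)

    byOrder : a ≤ b ⊎ b ≤ a → b ≤ c ⊎ c ≤ b → a ≤ c ⊎ c ≤ a → ⊥
    byOrder (inj₁ a≤b) (inj₁ b≤c) _          = sorted a≤b b≤c ab bc ac
    byOrder (inj₁ a≤b) (inj₂ c≤b) (inj₁ a≤c) = sorted a≤c c≤b ac (flip b c bc) ab
    byOrder (inj₁ a≤b) (inj₂ c≤b) (inj₂ c≤a) = sorted c≤a a≤b (flip a c ac) ab (flip b c bc)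
    byOrder (inj₂ b≤a) (inj₁ b≤c) (inj₁ a≤c) = sorted b≤a a≤c (flip a b ab) ac bc
    byOrder (inj₂ b≤a) (inj₁ b≤c) (inj₂ c≤a) = sorted b≤c c≤a bc (flip a c ac) (flip a b ab)
    byOrder (inj₂ b≤a) (inj₂ c≤b) _          = sorted c≤b b≤a (flip b c bc) (flip a b ab) (flip a c ac)

CycNextℕ : ℕ → ℕ → ℕ → Set
CycNextℕ k x y = suc x ≡ y ⊎ (suc x ≡ k × y ≡ 0)

cycNext-functional : ∀ {k x y y'} → y < k → y' < k → CycNextℕ k x y → CycNextℕ k x y' → y ≡ y'
cycNext-functional _ _ (inj₁ refl) (inj₁ refl) = refl
cycNext-functional y<k _ (inj₁ refl) (inj₂ (refl , _)) = ⊥-elim (<-irrefl refl y<k)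
cycNext-functional _ y'<k (inj₂ (refl , _)) (inj₁ refl) = ⊥-elim (<-irrefl refl y'<k)
cycNext-functional _ _ (inj₂ (_ , refl)) (inj₂ (_ , refl)) = refl

cycNext-injective : ∀ {k x x' y} → CycNextℕ k x y → CycNextℕ k x' y → x ≡ x'
cycNext-injective (inj₁ refl) (inj₁ refl) = refl
cycNext-injective (inj₂ (_ , refl)) (inj₁ ())
cycNext-injective (inj₂ (refl , _)) (inj₂ (e , _)) = suc-injective (sym e)

cycNext²-gapTwo : ∀ {k x y z} → 3 ≤ k → CycNextℕ k x y → CycNextℕ k y z → GapTwo k ∣ x - z ∣
cycNext²-gapTwo {x = x} _ (inj₁ refl) (inj₁ refl) =
  inj₁ (trans (cong ∣ x -_∣ (+-comm 2 x)) (∣m-m+n∣≡n x 2))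
cycNext²-gapTwo {x = x} _ (inj₁ refl) (inj₂ (refl , refl)) = inj₂ (cong (2 +_) (∣-∣-identityʳ x))
cycNext²-gapTwo {x = suc x} _ (inj₂ (refl , refl)) (inj₁ refl) = inj₂ (cong (2 +_) (∣-∣-identityʳ x))
cycNext²-gapTwo {x = zero} (s≤s (s≤s _)) (inj₂ (() , refl)) (inj₁ refl)
cycNext²-gapTwo (s≤s (s≤s _)) (inj₂ (_ , refl)) (inj₂ (() , _))

cycNext-fromGap : ∀ {k x y g} → y < k → x + g ≡ y → g ≡ 1 ⊎ suc g ≡ k → CycNextℕ k x y ⊎ CycNextℕ k y x
cycNext-fromGap {x = x} _ x+1≡y (inj₁ refl) = inj₁ (inj₁ (trans (+-comm 1 x) x+1≡y))
cycNext-fromGap {x = x} {g = g} y<k refl (inj₂ refl) = inj₂ (inj₂ (cong suc (cong (_+ g) x≡0) , x≡0))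
  where
    x≡0 : x ≡ 0
    x≡0 = n≤0⇒n≡0 (+-cancelʳ-≤ g x 0 (s≤s⁻¹ y<k))

suc-%≡ : ∀ m k .{{_ : NonZero k}} → suc m % k ≡ suc (m % k) % k
suc-%≡ m k = trans (cong (λ r → suc r % k) (m≡m%n+[m/n]*n m k)) ([m+kn]%n≡m%n (suc (m % k)) (m / k) k)

suc-%-cases : ∀ m k .{{_ : NonZero k}} → CycNextℕ k (m % k) (suc m % k)
suc-%-cases m k with m≤n⇒m<n∨m≡n (m%n<n m k)
... | inj₁ m%k+1<k = inj₁ (sym (trans (suc-%≡ m k) (m<n⇒m%n≡m m%k+1<k)))
... | inj₂ m%k+1≡k = inj₂ (m%k+1≡k , trans (suc-%≡ m k) (trans (cong (_% k) m%k+1≡k) (n%n≡0 k)))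

wlog-toℕ< : ∀ {k p} (P : Fin k → Fin k → Set p) → (∀ {i j} → P i j → P j i) →
  (∀ i j g → 1 ≤ g → g < k → toℕ i + g ≡ toℕ j → P i j) → ∀ i j → i ≢ j → P i j
wlog-toℕ< {k} P P-sym ordered i j i≢j = byOrder (<-cmp (toℕ i) (toℕ j))
  where
    byGap : ∀ i j → toℕ i < toℕ j → P i j
    byGap i j i<j = ordered i j (toℕ j ∸ toℕ i) (m<n⇒0<n∸m i<j)
      (≤-<-trans (m∸n≤m (toℕ j) (toℕ i)) (toℕ<n j)) (m+[n∸m]≡n (<⇒≤ i<j))

    byOrder : Tri (toℕ i < toℕ j) (toℕ i ≡ toℕ j) (toℕ j < toℕ i) → P i j
    byOrder (tri< i<j _ _) = byGap i j i<j
    byOrder (tri≈ _ i≡j _) = ⊥-elim (i≢j (toℕ-injective i≡j))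
    byOrder (tri> _ _ j<i) = P-sym (byGap j i j<i)

module _ {n} (G : Graph n) where
  open Graph G renaming (sym to Adj-sym)

  bipartite-noOddClosedWalk : ∀ {w} → NbhdBipartite G w → (f : ℕ → Fin n) (L : ℕ) → parity L ≡ 0ℙ →
    (∀ t → t ≤ L → Adj w (f t)) → (∀ t → t < L → Adj (f t) (f (suc t))) → ¬ Adj (f L) (f 0)
  bipartite-noOddClosedWalk (colour , proper) f L even inΓ step closing =
    proper (f L) (f 0) (inΓ L ≤-refl) (inΓ 0 z≤n) closing (sameColour L ≤-refl even)
    where
      flips : ∀ t → t < L → colour (f (suc t)) ≡ not (colour (f t))
      flips t t<L = ¬-not (proper _ _ (inΓ (suc t) t<L) (inΓ t (<⇒≤ t<L)) (Adj-sym (step t t<L)))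

      sameColour : ∀ t → t ≤ L → parity t ≡ 0ℙ → colour (f t) ≡ colour (f 0)
      sameColour zero _ _ = refl
      sameColour (suc zero) _ ()
      sameColour (suc (suc t)) t+2≤L even = begin
        colour (f (2 + t))        ≡⟨ flips (suc t) t+2≤L ⟩
        not (colour (f (1 + t)))  ≡⟨ cong not (flips t (<⇒≤ t+2≤L)) ⟩
        not (not (colour (f t)))  ≡⟨ not-involutive _ ⟩
        colour (f t)              ≡⟨ sameColour t (≤-trans (n≤1+n t) (<⇒≤ t+2≤L)) even ⟩
        colour (f 0)              ∎
        where open ≡-Reasoning

  inducedCycle-commonNeighbour-gapTwo : ∀ {k c} → 3 ≤ k → InducedCycle G k c →
    ∀ m i j → i ≢ j → Adj (c m) (c i) → Adj (c m) (c j) → GapTwo k ∣ toℕ i - toℕ j ∣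
  inducedCycle-commonNeighbour-gapTwo {k} 3≤k induced m i j i≢j m~i m~j
    with induced m i m~i | induced m j m~j
  ... | inj₁ m→i | inj₁ m→j =
    ⊥-elim (i≢j (toℕ-injective (cycNext-functional (toℕ<n i) (toℕ<n j) m→i m→j)))
  ... | inj₂ i→m | inj₂ j→m = ⊥-elim (i≢j (toℕ-injective (cycNext-injective i→m j→m)))
  ... | inj₂ i→m | inj₁ m→j = cycNext²-gapTwo 3≤k i→m m→j
  ... | inj₁ m→i | inj₂ j→m = subst (GapTwo k) (∣-∣-comm (toℕ j) (toℕ i)) (cycNext²-gapTwo 3≤k j→m m→i)

module CyclePositions {n} {G : Graph n} {k} {c : Fin k → Fin n} (C : IsCycle G k c) where
  open Graph G renaming (sym to Adj-sym)
  open IsCycle C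

  instance
    k-nonZero : NonZero k
    k-nonZero = >-nonZero (≤-trans (s≤s z≤n) len≥3)

  at : ℕ → Fin n
  at m = c (m mod k)

  toℕ-mod : ∀ m → toℕ (m mod k) ≡ m % k
  toℕ-mod m = toℕ-fromℕ< (m%n<n m k)

  at-toℕ : ∀ i → at (toℕ i) ≡ c i
  at-toℕ i = cong c (toℕ-injective (trans (toℕ-mod (toℕ i)) (m<n⇒m%n≡m (toℕ<n i))))

  at-+k : ∀ m → at (m + k) ≡ at m
  at-+k m = cong c (toℕ-injective (trans (toℕ-mod (m + k)) (trans ([m+n]%n≡m%n m k) (sym (toℕ-mod m)))))

  at-adj : ∀ m → Adj (at m) (at (suc m))
  at-adj m = edges _ _ (subst₂ (CycNextℕ k) (sym (toℕ-mod m)) (sym (toℕ-mod (suc m))) (suc-%-cases m k))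

  at-injective : ∀ s {t t'} → t < k → t' < k → at (s + t) ≡ at (s + t') → t ≡ t'
  at-injective s t<k t'<k eq =
    %-injectiveʳ s t<k t'<k (trans (sym (toℕ-mod _)) (trans (cong toℕ (inj _ _ eq)) (toℕ-mod _)))

  at-gap : ∀ (i j : Fin k) {g} → toℕ i + g ≡ toℕ j → at (toℕ i + g) ≡ c j
  at-gap i j i+g≡j = trans (cong at i+g≡j) (at-toℕ j)

  arcWalk : Fin n → ℕ → ℕ → Fin n
  arcWalk x s zero = x
  arcWalk x s (suc t) = at (s + t)

  arcWalk-adj : ∀ x s → Adj x (at s) → ∀ t → Adj (arcWalk x s t) (arcWalk x s (suc t))
  arcWalk-adj x s x~s zero = subst (λ m → Adj x (at m)) (sym (+-identityʳ s)) x~s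
  arcWalk-adj x s x~s (suc t) = subst (λ m → Adj (at (s + t)) (at m)) (sym (+-suc s t)) (at-adj (s + t))

  closeArc : Fin n → ℕ → (l : ℕ) → Fin (2 + l) → Fin n
  closeArc x s l i = arcWalk x s (toℕ i)

  closeArc-isCycle : ∀ x s l → 1 ≤ l → l < k → (∀ t → t ≤ l → x ≢ at (s + t)) →
    Adj x (at s) → Adj x (at (s + l)) → IsCycle G (2 + l) (closeArc x s l)
  closeArc-isCycle x s l 1≤l l<k x∉arc x~s x~e =
    record { len≥3 = s≤s (s≤s 1≤l) ; inj = injective ; edges = closeArc-edges }
    where
      onArc : ∀ (i : Fin (suc l)) → toℕ i ≤ l
      onArc i = s≤s⁻¹ (toℕ<n i)

      injective : ∀ i j → closeArc x s l i ≡ closeArc x s l j → i ≡ j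
      injective zero zero _ = refl
      injective zero (suc j) x≡ = ⊥-elim (x∉arc (toℕ j) (onArc j) x≡)
      injective (suc i) zero ≡x = ⊥-elim (x∉arc (toℕ i) (onArc i) (sym ≡x))
      injective (suc i) (suc j) eq =
        cong suc (toℕ-injective (at-injective s (≤-<-trans (onArc i) l<k) (≤-<-trans (onArc j) l<k) eq))

      closeArc-edges : ∀ i j → CycNext (2 + l) i j → Adj (closeArc x s l i) (closeArc x s l j)
      closeArc-edges i j (inj₁ i+1≡j) =
        subst (λ t → Adj (closeArc x s l i) (arcWalk x s t)) i+1≡j (arcWalk-adj x s x~s (toℕ i))
      closeArc-edges i j (inj₂ (i+1≡2+l , j≡0)) =
        subst₂ (λ a b → Adj (arcWalk x s a) (arcWalk x s b))
          (sym (suc-injective i+1≡2+l)) (sym j≡0) (Adj-sym x~e)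

module ShortestOddCycle {n} (G : Graph n) (LB : LocallyBipartite G) (u v : Fin n) (SP : SparsePair G u v)
  {k} {c : Fin k → Fin n} (SG : ShortestGoodCycle G u v k c) where
  open Graph G renaming (sym to Adj-sym)
  open GoodCycle (proj₁ SG)
  open IsCycle cycle
  open CyclePositions cycle

  k-odd : parity k ≡ 1ℙ
  k-odd = Odd⇒parity≡1ℙ odd

  InΓu∪v : Fin n → Set
  InΓu∪v x = x ≡ v ⊎ Adj u x

  at-inΓu∪v : ∀ m → InΓu∪v (at m)
  at-inΓu∪v m with at m ≟ᶠ v
  ... | yes at≡v = inj₁ at≡v
  ... | no at≢v = inj₂ (restInΓu (m mod k) at≢v)

  k≤2+oddArc : ∀ x s l → 1 ≤ l → l < k → (∀ t → t ≤ l → x ≢ at (s + t)) → InΓu∪v x →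
    Adj x (at s) → Adj x (at (s + l)) → parity l ≡ 1ℙ → k ≤ 2 + l
  k≤2+oddArc x s l 1≤l l<k x∉arc x-near x~s x~e l-odd = byV (any? (λ i → closeArc x s l i ≟ᶠ v))
    where
      near : ∀ i → InΓu∪v (closeArc x s l i)
      near zero = x-near
      near (suc i) = at-inΓu∪v (s + toℕ i)

      byV : Dec (∃ λ i → closeArc x s l i ≡ v) → k ≤ 2 + l
      byV (yes v∈C') = proj₂ SG (2 + l) (closeArc x s l) record
        { cycle = closeArc-isCycle x s l 1≤l l<k x∉arc x~s x~e
        ; odd = parity≡1ℙ⇒Odd (2 + l) l-odd
        ; throughV = v∈C'
        ; restInΓu = λ i ≢v → [ (λ ≡v → ⊥-elim (≢v ≡v)) , id ] (near i) }
      byV (no v∉C') = ⊥-elim (bipartite-noOddClosedWalk G (LB u) (arcWalk x s) (suc l)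
        (parity-suc-odd {l} l-odd) inΓu (λ t _ → arcWalk-adj x s x~s t) (Adj-sym x~e))
        where
          inΓu : ∀ t → t ≤ suc l → Adj u (arcWalk x s t)
          inΓu t t≤1+l = subst (λ t → Adj u (arcWalk x s t)) (toℕ-fromℕ< (s≤s t≤1+l))
            ([ (λ ≡v → ⊥-elim (v∉C' (fromℕ< (s≤s t≤1+l) , ≡v))) , id ] (near (fromℕ< (s≤s t≤1+l))))

  noChord : ∀ a l₁ l₂ → 1 ≤ l₁ → 1 ≤ l₂ → 2 + l₁ + l₂ ≡ k → ¬ Adj (at a) (at (suc a + l₁))
  noChord a l₁ l₂ 1≤l₁ 1≤l₂ total chord =
    byParity (parity-+≡1ℙ l₁ l₂ (trans (cong parity total) k-odd))
    where
      s₂ = suc a + l₁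

      2+l₁≤k : 2 + l₁ ≤ k
      2+l₁≤k = subst (2 + l₁ ≤_) total (m≤m+n (2 + l₁) l₂)

      total' : 2 + l₂ + l₁ ≡ k
      total' = trans (cong (2 +_) (+-comm l₂ l₁)) total

      2+l₂≤k : 2 + l₂ ≤ k
      2+l₂≤k = subst (2 + l₂ ≤_) total' (m≤m+n (2 + l₂) l₁)

      wraps : at (s₂ + suc l₂) ≡ at a
      wraps = trans (cong at (trans (arith a l₁ l₂) (cong (a +_) total))) (at-+k a)
        where
          arith : ∀ a l₁ l₂ → suc a + l₁ + suc l₂ ≡ a + (2 + l₁ + l₂)
          arith = solve-∀

      byParity : (parity l₁ ≡ 1ℙ × parity l₂ ≡ 0ℙ) ⊎ (parity l₁ ≡ 0ℙ × parity l₂ ≡ 1ℙ) → ⊥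
      byParity (inj₁ (l₁-odd , _)) = <⇒≱ (m<m+n (2 + l₁) 1≤l₂) (subst (_≤ 2 + l₁) (sym total)
        (k≤2+oddArc (at a) (suc a) l₁ 1≤l₁ (<⇒≤ 2+l₁≤k) before₁ (at-inΓu∪v a) (at-adj a) chord l₁-odd))
        where
          before₁ : ∀ t → t ≤ l₁ → at a ≢ at (suc a + t)
          before₁ t t≤l₁ e = 0≢1+n (at-injective a (≤-trans (s≤s z≤n) 2+l₁≤k)
            (≤-trans (s≤s (s≤s t≤l₁)) 2+l₁≤k)
            (trans (cong at (+-identityʳ a)) (trans e (cong at (sym (+-suc a t))))))
      byParity (inj₂ (_ , l₂-odd)) = <⇒≱ (m<m+n (2 + l₂) 1≤l₁) (subst (_≤ 2 + l₂) (sym total')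
        (k≤2+oddArc (at a) s₂ l₂ 1≤l₂ (<⇒≤ 2+l₂≤k) before₂ (at-inΓu∪v a) chord closing l₂-odd))
        where
          before₂ : ∀ t → t ≤ l₂ → at a ≢ at (s₂ + t)
          before₂ t t≤l₂ e = 1+n≰n (subst (_≤ l₂)
            (at-injective s₂ (<-≤-trans (s≤s t≤l₂) (<⇒≤ 2+l₂≤k)) 2+l₂≤k (trans (sym e) (sym wraps)))
            t≤l₂)
          closing : Adj (at a) (at (s₂ + l₂))
          closing = Adj-sym (subst (Adj (at (s₂ + l₂)))
            (trans (cong at (sym (+-suc s₂ l₂))) wraps) (at-adj (s₂ + l₂)))

  adjacent⇒gap≡1 : ∀ a g → 1 ≤ g → g < k → Adj (at a) (at (a + g)) → g ≡ 1 ⊎ suc g ≡ k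
  adjacent⇒gap≡1 a (suc zero) _ _ _ = inj₁ refl
  adjacent⇒gap≡1 a g@(suc (suc l₁)) _ g<k chord with k ∸ g in rest
  ... | zero = ⊥-elim (<⇒≱ g<k (m∸n≡0⇒m≤n rest))
  ... | suc zero = inj₂ (trans (+-comm 1 g) (trans (cong (g +_) (sym rest)) (m+[n∸m]≡n (<⇒≤ g<k))))
  ... | suc (suc l₂) = ⊥-elim (noChord a (suc l₁) (suc l₂) (s≤s z≤n) (s≤s z≤n) total
                         (subst (λ m → Adj (at a) (at m)) (+-suc a (suc l₁)) chord))
    where
      total : 2 + suc l₁ + suc l₂ ≡ k
      total = trans (sym (cong suc (+-suc (suc l₁) (suc l₂))))
                (trans (cong (g +_) (sym rest)) (m+[n∸m]≡n (<⇒≤ g<k)))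

  induced : InducedCycle G k c
  induced i j adj =
    wlog-toℕ< P P-sym ordered i j (λ i≡j → irrefl (subst (λ j → Adj (c i) (c j)) (sym i≡j) adj)) adj
    where
      P : Fin k → Fin k → Set
      P i j = Adj (c i) (c j) → CycNext k i j ⊎ CycNext k j i

      P-sym : ∀ {i j} → P i j → P j i
      P-sym p adj = swap (p (Adj-sym adj))

      ordered : ∀ i j g → 1 ≤ g → g < k → toℕ i + g ≡ toℕ j → P i j
      ordered i j g 1≤g g<k i+g≡j adj = cycNext-fromGap (toℕ<n j) i+g≡j
        (adjacent⇒gap≡1 (toℕ i) g 1≤g g<k (subst₂ Adj (sym (at-toℕ i)) (sym (at-gap i j i+g≡j)) adj))

  externalNeighbour-gapTwo : ∀ w → Adj u w → (∀ m → w ≢ at m) → ∀ a g → 1 ≤ g → g < k →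
    Adj w (at a) → Adj w (at (a + g)) → GapTwo k g
  externalNeighbour-gapTwo w u~w w∉C a g 1≤g g<k w~a w~a+g =
    byParity (parity-+≡1ℙ g l (trans (cong parity g+l≡k) k-odd))
    where
      l = k ∸ g

      g+l≡k : g + l ≡ k
      g+l≡k = m+[n∸m]≡n (<⇒≤ g<k)

      l+g≡k : l + g ≡ k
      l+g≡k = trans (+-comm l g) g+l≡k

      w~a+g+l : Adj w (at (a + g + l))
      w~a+g+l = subst (Adj w)
        (sym (trans (cong at (trans (+-assoc a g l) (cong (a +_) g+l≡k))) (at-+k a))) w~a

      rest≤2 : ∀ {m m'} → m + m' ≡ k → k ≤ 2 + m → m' ≤ 2
      rest≤2 {m} {m'} m+m'≡k k≤2+m = +-cancelˡ-≤ m m' 2 (subst₂ _≤_ (sym m+m'≡k) (+-comm 2 m) k≤2+m)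

      byParity : (parity g ≡ 1ℙ × parity l ≡ 0ℙ) ⊎ (parity g ≡ 0ℙ × parity l ≡ 1ℙ) → GapTwo k g
      byParity (inj₁ (g-odd , l-even)) = inj₂ (trans (+-comm 2 g) (subst (λ r → g + r ≡ k) l≡2 g+l≡k))
        where
          l≡2 : l ≡ 2
          l≡2 = even-1≤-≤2 (m<n⇒0<n∸m g<k) (rest≤2 g+l≡k
            (k≤2+oddArc w a g 1≤g g<k (λ t _ → w∉C (a + t)) (inj₂ u~w) w~a w~a+g g-odd)) l-even
      byParity (inj₂ (g-even , l-odd)) = inj₁ (even-1≤-≤2 1≤g (rest≤2 l+g≡k
        (k≤2+oddArc w (a + g) l (m<n⇒0<n∸m g<k) (subst (l <_) l+g≡k (m<m+n l 1≤g))
          (λ t _ → w∉C (a + g + t)) (inj₂ u~w) w~a+g w~a+g+l l-odd)) g-even)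

  neighbour-gapTwo : ∀ w → Adj u w → ∀ i j → i ≢ j → Adj w (c i) → Adj w (c j) →
    GapTwo k ∣ toℕ i - toℕ j ∣
  neighbour-gapTwo w u~w i j i≢j with any? (λ m → w ≟ᶠ c m)
  ... | yes (m , refl) = inducedCycle-commonNeighbour-gapTwo G len≥3 induced m i j i≢j
  ... | no w∉C = wlog-toℕ< P P-sym ordered i j i≢j
    where
      P : Fin k → Fin k → Set
      P i j = Adj w (c i) → Adj w (c j) → GapTwo k ∣ toℕ i - toℕ j ∣

      P-sym : ∀ {i j} → P i j → P j i
      P-sym {i} {j} p w~j w~i = subst (GapTwo k) (∣-∣-comm (toℕ i) (toℕ j)) (p w~i w~j)

      ordered : ∀ i j g → 1 ≤ g → g < k → toℕ i + g ≡ toℕ j → P i j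
      ordered i j g 1≤g g<k i+g≡j w~i w~j =
        subst (GapTwo k) (sym (trans (cong (∣ toℕ i -_∣) (sym i+g≡j)) (∣m-m+n∣≡n (toℕ i) g)))
          (externalNeighbour-gapTwo w u~w (λ m → w∉C ∘ (m mod k ,_)) (toℕ i) g 1≤g g<k
            (subst (Adj w) (sym (at-toℕ i)) w~i) (subst (Adj w) (sym (at-gap i j i+g≡j)) w~j))

  k≢3 : k ≢ 3
  k≢3 k≡3 = proj₂ SP (at (p + 1)) (at (p + 2))
    (u~ 1 (s≤s z≤n) 1<k) v~p+1 (u~ 2 (s≤s z≤n) len≥3) v~p+2 p+1~p+2
    where
      p = toℕ (proj₁ throughV)

      at-p : at p ≡ v
      at-p = trans (at-toℕ _) (proj₂ throughV)

      1<k : 1 < k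
      1<k = ≤-trans (s≤s (s≤s z≤n)) len≥3

      u~ : ∀ t → 0 < t → t < k → Adj u (at (p + t))
      u~ t 0<t t<k = restInΓu _ λ at≡v → <⇒≢ 0<t (at-injective p (≤-<-trans z≤n t<k) t<k
        (trans (cong at (+-identityʳ p)) (trans at-p (sym at≡v))))

      v~p+1 : Adj v (at (p + 1))
      v~p+1 = subst₂ Adj at-p (cong at (+-comm 1 p)) (at-adj p)

      p+1~p+2 : Adj (at (p + 1)) (at (p + 2))
      p+1~p+2 = subst (λ m → Adj (at (p + 1)) (at m)) (sym (+-suc p 1)) (at-adj (p + 1))

      v~p+2 : Adj v (at (p + 2))
      v~p+2 = Adj-sym (subst (Adj (at (p + 2)))
        (trans (cong at (trans (sym (+-suc p 2)) (cong (p +_) (sym k≡3)))) (trans (at-+k p) at-p))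
        (at-adj (p + 2)))

  4≤k : 4 ≤ k
  4≤k = ≤∧≢⇒< len≥3 (k≢3 ∘ sym)

  neighbour-cycDist≡2 : ∀ w → Adj u w → ∀ i j → i ≢ j → Adj w (c i) → Adj w (c j) → cycDist k i j ≡ 2
  neighbour-cycDist≡2 w u~w i j i≢j w~i w~j = gapTwo⇒⊓≡2 4≤k (neighbour-gapTwo w u~w i j i≢j w~i w~j)

  noThreeNeighbours : ∀ w → Adj u w → ∀ i j l → i ≢ j → j ≢ l → i ≢ l →
    ¬ (Adj w (c i) × Adj w (c j) × Adj w (c l))
  noThreeNeighbours w u~w i j l i≢j j≢l i≢l (w~i , w~j , w~l) =
    noGapTwoTriangle 4≤k k-odd (toℕ i) (toℕ j) (toℕ l)
      (neighbour-gapTwo w u~w i j i≢j w~i w~j)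
      (neighbour-gapTwo w u~w j l j≢l w~j w~l)
      (neighbour-gapTwo w u~w i l i≢l w~i w~l)

lemma3p9 : ∀ {n : ℕ} (G : Graph n) → LocallyBipartite G →
    ∀ (u v : Fin n) → SparsePair G u v →
    ∀ (k : ℕ) (c : Fin k → Fin n) → ShortestGoodCycle G u v k c →
    ((w : Fin n) → Graph.Adj G u w →
      (∀ (i j l : Fin k) → i ≢ j → j ≢ l → i ≢ l →
        ¬ (Graph.Adj G w (c i) × Graph.Adj G w (c j) × Graph.Adj G w (c l)))
      × (∀ (i j : Fin k) → i ≢ j → Graph.Adj G w (c i) → Graph.Adj G w (c j) →
        cycDist k i j ≡ 2))
    × InducedCycle G k c
lemma3p9 G LB u v SP k c SG =
  (λ w u~w → noThreeNeighbours w u~w , neighbour-cycDist≡2 w u~w) , induced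
  where open ShortestOddCycle G LB u v SP SG
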